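{- Let $q$ be a prime power and let $\mathcal{M}$ be a class of simple $GF(q)$-representable matroids that is closed under taking induced minors. Let $\widehat{\mathcal{M}}$ be the class of matroids consisting of the members of $\mathcal{M}$ together with all matroids obtainable from members of $\mathcal{M}$ by repeatedly taking $q$-conings. Then $\widehat{\mathcal{M}}$ is closed under taking induced minors.
   Context: All matroids are simple; every contraction is immediately followed by simplification. An induced minor of $M$ is a matroid obtained from $M$ by a sequence of restrictions to flats and contractions (each contraction followed by simplification). For a simple $GF(q)$-representable matroid $N$ (viewed as a restriction of a projective geometry over $GF(q)$), its $q$-coning $A(N)$ is the $GF(q)$-representable matroid obtained by adding a coloop $p$ (the tip) to $N$ and then adding every point on each projective line between $p$ and a point of $N$. -}

module Defs where

open import Level using (0ℓ)
open import Data.Nat using (ℕ; suc; _^_)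
open import Data.Nat.Primality using (Prime)
open import Data.Fin using (Fin)
open import Data.Vec using (Vec; []; _∷_; replicate; map; zipWith)
open import Data.Product using (Σ; ∃; _×_; _,_; proj₁; proj₂)
open import Data.Sum using (_⊎_; inj₁; inj₂)
open import Data.Empty using (⊥; ⊥-elim)
open import Relation.Nullary using (¬_)
open import Relation.Binary.PropositionalEquality
open import Relation.Binary.Construct.Closure.ReflexiveTransitive using (Star)
open import Algebra.Structures using (IsCommutativeRing)
open import Function.Bundles using (_↔_; _⇔_)

IsPrimePower : ℕ → Set
IsPrimePower q = Σ ℕ λ p → Σ ℕ λ k → Prime p × q ≡ p ^ suc k

record FiniteField (q : ℕ) : Set₁ where
  infixl 7 _*_
  infixl 6 _+_
  field
    Carrier : Set
    _+_ _*_ : Carrier → Carrier → Carrier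
    -_      : Carrier → Carrier
    0# 1#   : Carrier
    isCommutativeRing : IsCommutativeRing _≡_ _+_ _*_ -_ 0# 1#
    0≢1     : ¬ (0# ≡ 1#)
    inverse : ∀ x → ¬ (x ≡ 0#) → Σ Carrier λ y → y * x ≡ 1#
    card    : Fin q ↔ Carrier
  open IsCommutativeRing isCommutativeRing public
    using (zeroʳ; zeroˡ; *-assoc; *-identityˡ)

module OverField {q : ℕ} (F : FiniteField q) where
  open FiniteField F

  zeroV : (n : ℕ) → Vec Carrier n
  zeroV n = replicate n 0#

  _⊕_ : ∀ {n} → Vec Carrier n → Vec Carrier n → Vec Carrier n
  _⊕_ = zipWith _+_

  _·_ : ∀ {n} → Carrier → Vec Carrier n → Vec Carrier n
  a · v = map (a *_) v

  record IsLinear {k n : ℕ} (f : Vec Carrier k → Vec Carrier n) : Set where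
    field
      additive    : ∀ u v → f (u ⊕ v) ≡ f u ⊕ f v
      homogeneous : ∀ a v → f (a · v) ≡ a · f v

  InjectiveMap : {k n : ℕ} → (Vec Carrier k → Vec Carrier n) → Set
  InjectiveMap f = ∀ u v → f u ≡ f v → u ≡ v

  -- A simple GF(q)-represented matroid: a set of points of the projective
  -- geometry PG(dim-1, q), encoded as a set of nonzero vectors of F^dim
  -- closed under nonzero scalar multiples (each projective point is the set
  -- of nonzero multiples of a vector).
  record RepMatroid : Set₁ where
    field
      dim     : ℕ
      pts     : Vec Carrier dim → Set
      nonzero : ∀ v → pts v → ¬ (v ≡ zeroV dim)
      scaled  : ∀ a v → ¬ (a ≡ 0#) → pts v → pts (a · v)
  open RepMatroid public

  -- One step of taking an induced minor:  N is obtained from M by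
  --  * restriction to a flat (the flats of M are exactly the sets M ∩ W for
  --    subspaces W; W is the image of an injective linear φ, so this also
  --    covers projective equivalences), or
  --  * contraction of a point e of M followed by simplification: a linear
  --    map ψ whose kernel is exactly the span of e, N = ψ(M) minus 0
  --    (the image set is automatically simple), or
  --  * re-embedding into another ambient space by an injective linear map
  --    (an isomorphism of matroids; the contraction of the empty set).
  data Step (M N : RepMatroid) : Set where
    restrict :
      (φ : Vec Carrier (dim N) → Vec Carrier (dim M)) →
      IsLinear φ → InjectiveMap φ →
      (∀ v → pts N v ⇔ pts M (φ v)) →
      Step M N
    contract :
      (e : Vec Carrier (dim M)) → pts M e →
      (ψ : Vec Carrier (dim M) → Vec Carrier (dim N)) → IsLinear ψ →
      (∀ v → (ψ v ≡ zeroV (dim N)) ⇔ (Σ Carrier λ a → v ≡ a · e)) →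
      (∀ w → pts N w ⇔ (¬ (w ≡ zeroV (dim N)) ×
                         (Σ (Vec Carrier (dim M)) λ v → pts M v × ψ v ≡ w))) →
      Step M N
    reembed :
      (ψ : Vec Carrier (dim M) → Vec Carrier (dim N)) →
      IsLinear ψ → InjectiveMap ψ →
      (∀ w → pts N w ⇔ (Σ (Vec Carrier (dim M)) λ v → pts M v × ψ v ≡ w)) →
      Step M N

  IsInducedMinor : RepMatroid → RepMatroid → Set₁
  IsInducedMinor N M = Star Step M N

  Class : Set₂
  Class = RepMatroid → Set₁

  ClosedUnderInducedMinors : Class → Set₁
  ClosedUnderInducedMinors 𝓜 = ∀ M N → 𝓜 M → IsInducedMinor N M → 𝓜 N

  private
    ·-zero : ∀ {n} a → a · zeroV n ≡ zeroV n
    ·-zero {0} a = refl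
    ·-zero {suc n} a = cong₂ _∷_ (zeroʳ a) (·-zero {n} a)

    noZeroDiv : ∀ a x → ¬ (a ≡ 0#) → ¬ (x ≡ 0#) → ¬ (a * x ≡ 0#)
    noZeroDiv a x a≢0 x≢0 ax≡0 with inverse a a≢0
    ... | b , ba≡1 = x≢0 (begin
          x             ≡⟨ sym (*-identityˡ x) ⟩
          1# * x        ≡⟨ cong (_* x) (sym ba≡1) ⟩
          (b * a) * x   ≡⟨ *-assoc b a x ⟩
          b * (a * x)   ≡⟨ cong (b *_) ax≡0 ⟩
          b * 0#        ≡⟨ zeroʳ b ⟩
          0# ∎)
      where open ≡-Reasoning

    ∷-inj : ∀ {n} {x y : Carrier} {u v : Vec Carrier n} →
            x ∷ u ≡ y ∷ v → x ≡ y × u ≡ v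
    ∷-inj refl = refl , refl

  -- q-coning A(N): N lies in the hyperplane x₀ = 0 of F^(dim N + 1), the tip
  -- is p = (1,0,…,0) (a coloop), and A(N) consists of all points on the
  -- lines through p and a point of N, i.e. the vectors a·p + b·e with e ∈ N
  -- and (a,b) ≠ (0,0):  either the tip (u = 0, a ≠ 0) or (a ∷ u) with u ∈ N.
  cone : RepMatroid → RepMatroid
  cone N = record
    { dim = suc (dim N)
    ; pts = conePts
    ; nonzero = nz
    ; scaled = sc
    }
    where
      conePts : Vec Carrier (suc (dim N)) → Set
      conePts (a ∷ u) = (u ≡ zeroV (dim N) × ¬ (a ≡ 0#)) ⊎ pts N u

      nz : ∀ v → conePts v → ¬ (v ≡ zeroV (suc (dim N)))
      nz (a ∷ u) (inj₁ (_ , a≢0)) eq = a≢0 (proj₁ (∷-inj eq))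
      nz (a ∷ u) (inj₂ pu) eq = nonzero N u pu (proj₂ (∷-inj eq))

      sc : ∀ c v → ¬ (c ≡ 0#) → conePts v → conePts (c · v)
      sc c (a ∷ u) c≢0 (inj₁ (u≡0 , a≢0)) =
        inj₁ (trans (cong (c ·_) u≡0) (·-zero c) , noZeroDiv c a c≢0 a≢0)
      sc c (a ∷ u) c≢0 (inj₂ pu) = inj₂ (scaled N c u c≢0 pu)

  Equivalent : RepMatroid → RepMatroid → Set
  Equivalent M N = Σ (Vec Carrier (dim M) → Vec Carrier (dim N)) λ ψ →
      IsLinear ψ × InjectiveMap ψ ×
      (∀ w → pts N w ⇔ (Σ (Vec Carrier (dim M)) λ v → pts M v × ψ v ≡ w))

  data Hat (𝓜 : Class) : Class where
    base : ∀ {M} → 𝓜 M → Hat 𝓜 M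
    coned : ∀ {N M} → Hat 𝓜 N → Equivalent (cone N) M → Hat 𝓜 M

{-# OPTIONS --safe #-}

-- An induced minor of a q-cone A(N) is either an induced minor of N or a copy of the q-cone over
-- one, and it suffices to check this for a single step of an induced-minor sequence (a step
-- starting from a copy of a cone is first transported back to the cone itself).  A flat of A(N)
-- avoiding the tip p projects isomorphically, away from p, onto a flat of N, while a flat
-- through p is the cone over its intersection with N.  Contracting p leaves a copy of N, and
-- contracting any other point, which lies on the line through p and some point u of N, gives
-- the cone over N/u whose tip is the image of p.  Induction along the construction of a member
-- of \widehat{M} then closes the class under induced minors.

module Submission where

open import Defs
open import Level using (0ℓ)
open import Data.Nat using (ℕ; zero; suc)
open import Data.Fin using (Fin)
import Data.Fin.Properties as Fin
open import Data.Vec using (Vec; []; _∷_; replicate; head; tail)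
import Data.Vec.Properties as Vec
open import Data.Product using (∃; _×_; _,_; proj₁; proj₂)
open import Data.Product.Function.NonDependent.Propositional using (_×-⇔_)
open import Data.Sum using (_⊎_; inj₁; inj₂)
open import Data.Empty using (⊥-elim)
open import Relation.Nullary using (¬_; Dec; yes; no)
import Relation.Nullary.Decidable as Dec
open import Relation.Binary.Definitions using (DecidableEquality)
open import Relation.Binary.PropositionalEquality hiding (J)
open import Relation.Binary.Construct.Closure.ReflexiveTransitive using (ε; _◅_; _◅◅_)
open import Function.Base using (_∘_; id)
open import Function.Bundles using (_↔_; _⇔_; mk⇔; Inverse; Equivalence)
open import Function.Properties.Equivalence
  using () renaming (refl to ⇔-refl; sym to ⇔-sym; trans to ⇔-trans)
open import Function.Properties.Inverse using (↔⇒↣; ↔-sym)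
open import Algebra.Bundles using (AbelianGroup; Ring)
open import Algebra.Structures using (IsCommutativeRing; IsAbelianGroup)
import Algebra.Properties.AbelianGroup as AbelianGroupProperties
import Algebra.Properties.CommutativeSemigroup as CommutativeSemigroupProperties
import Algebra.Properties.Ring as RingProperties

Searchable : Set → Set₁
Searchable A = (P : A → Set) → (∀ x → Dec (P x)) → Dec (∃ P)

Fin-searchable : ∀ n → Searchable (Fin n)
Fin-searchable n P P? = Fin.any? P?

↔-searchable : ∀ {A B : Set} → A ↔ B → Searchable A → Searchable B
↔-searchable A↔B A? P P? =
  Dec.map′ (λ (x , p) → to x , p)
           (λ (y , p) → from y , subst P (sym (strictlyInverseˡ y)) p)
           (A? (P ∘ to) (P? ∘ to))
  where open Inverse A↔B using (to; from; strictlyInverseˡ)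

Vec-searchable : ∀ {A : Set} → Searchable A → ∀ n → Searchable (Vec A n)
Vec-searchable A? zero P P? = Dec.map′ ([] ,_) (λ { ([] , p) → p }) (P? [])
Vec-searchable A? (suc n) P P? =
  Dec.map′ (λ (x , xs , p) → x ∷ xs , p) (λ { (x ∷ xs , p) → x , xs , p })
           (A? _ λ x → Vec-searchable A? n (P ∘ (x ∷_)) (P? ∘ (x ∷_)))

module _ {q : ℕ} (F : FiniteField q) where
  open FiniteField F
  open OverField F
  open IsCommutativeRing isCommutativeRing
    using (+-assoc; +-comm; +-identityˡ; +-identityʳ; distribˡ; distribʳ;
           *-comm; *-identityʳ; -‿inverseˡ; -‿inverseʳ; isRing)
  open Equivalence using (to; from)

  -- Scalars and vectors

  ring : Ring 0ℓ 0ℓ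
  ring = record { isRing = isRing }

  open RingProperties ring using (-1*x≈-x)

  _≟_ : DecidableEquality Carrier
  _≟_ = Dec.via-injection (↔⇒↣ (↔-sym card)) Fin._≟_

  Carrier-searchable : Searchable Carrier
  Carrier-searchable = ↔-searchable card (Fin-searchable q)

  infix 30 _⁻¹⟨_⟩
  _⁻¹⟨_⟩ : (x : Carrier) → ¬ x ≡ 0# → Carrier
  x ⁻¹⟨ x≢0 ⟩ = proj₁ (inverse x x≢0)

  ⁻¹-inverseˡ : ∀ x (x≢0 : ¬ x ≡ 0#) → x ⁻¹⟨ x≢0 ⟩ * x ≡ 1#
  ⁻¹-inverseˡ x x≢0 = proj₂ (inverse x x≢0)

  *-⁻¹-cancelʳ : ∀ {x} (x≢0 : ¬ x ≡ 0#) y → y * x ⁻¹⟨ x≢0 ⟩ * x ≡ y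
  *-⁻¹-cancelʳ {x} x≢0 y =
    trans (*-assoc y _ x) (trans (cong (y *_) (⁻¹-inverseˡ x x≢0)) (*-identityʳ y))

  x*y≡0⇒y≡0 : ∀ {x y} → ¬ x ≡ 0# → x * y ≡ 0# → y ≡ 0#
  x*y≡0⇒y≡0 {x} {y} x≢0 xy≡0 = begin
    y                       ≡⟨ sym (*-identityˡ y) ⟩
    1# * y                  ≡⟨ cong (_* y) (sym (⁻¹-inverseˡ x x≢0)) ⟩
    x ⁻¹⟨ x≢0 ⟩ * x * y     ≡⟨ *-assoc _ x y ⟩
    x ⁻¹⟨ x≢0 ⟩ * (x * y)   ≡⟨ cong (x ⁻¹⟨ x≢0 ⟩ *_) xy≡0 ⟩
    x ⁻¹⟨ x≢0 ⟩ * 0#        ≡⟨ zeroʳ _ ⟩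
    0#                      ∎
    where open ≡-Reasoning

  x-y+y≡x : ∀ x y → x + - y + y ≡ x
  x-y+y≡x x y = trans (+-assoc x (- y) y) (trans (cong (x +_) (-‿inverseˡ y)) (+-identityʳ x))

  V : ℕ → Set
  V = Vec Carrier

  0v : ∀ {n} → V n
  0v {n} = zeroV n

  neg : ∀ {n} → V n → V n
  neg v = (- 1#) · v

  infixl 6 _⊖_
  _⊖_ : ∀ {n} → V n → V n → V n
  u ⊖ v = u ⊕ neg v

  tip : ∀ {n} → V (suc n)
  tip = 1# ∷ 0v

  ι : ∀ {n} → V n → V (suc n)
  ι = 0# ∷_

  ·-distribˡ : ∀ {n} a (u v : V n) → a · (u ⊕ v) ≡ (a · u) ⊕ (a · v)
  ·-distribˡ a [] [] = refl
  ·-distribˡ a (x ∷ u) (y ∷ v) = cong₂ _∷_ (distribˡ a x y) (·-distribˡ a u v)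

  ·-distribʳ : ∀ {n} a b (v : V n) → (a + b) · v ≡ (a · v) ⊕ (b · v)
  ·-distribʳ a b [] = refl
  ·-distribʳ a b (x ∷ v) = cong₂ _∷_ (distribʳ x a b) (·-distribʳ a b v)

  ·-assoc : ∀ {n} a b (v : V n) → (a * b) · v ≡ a · (b · v)
  ·-assoc a b v = trans (Vec.map-cong (*-assoc a b) v) (Vec.map-∘ (a *_) (b *_) v)

  ·-identityˡ : ∀ {n} (v : V n) → 1# · v ≡ v
  ·-identityˡ v = trans (Vec.map-cong *-identityˡ v) (Vec.map-id v)

  ·-zeroˡ : ∀ {n} (v : V n) → 0# · v ≡ 0v
  ·-zeroˡ v = trans (Vec.map-cong zeroˡ v) (Vec.map-const v 0#)

  ·-zeroʳ : ∀ {n} a → a · 0v {n} ≡ 0v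
  ·-zeroʳ {n} a = trans (Vec.map-replicate (a *_) 0# n) (cong (replicate n) (zeroʳ a))

  ·-tip : ∀ {n} b → b · tip {n} ≡ b ∷ 0v
  ·-tip b = cong₂ _∷_ (*-identityʳ b) (·-zeroʳ b)

  ⊖-inverseʳ : ∀ {n} (v : V n) → v ⊖ v ≡ 0v
  ⊖-inverseʳ v = begin
    v ⊕ ((- 1#) · v)          ≡⟨ cong (_⊕ ((- 1#) · v)) (sym (·-identityˡ v)) ⟩
    (1# · v) ⊕ ((- 1#) · v)   ≡⟨ sym (·-distribʳ 1# (- 1#) v) ⟩
    (1# + - 1#) · v           ≡⟨ cong (_· v) (-‿inverseʳ 1#) ⟩
    0# · v                    ≡⟨ ·-zeroˡ v ⟩
    0v                        ∎
    where open ≡-Reasoning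

  ⊕-isAbelianGroup : ∀ n → IsAbelianGroup _≡_ (_⊕_ {n}) 0v neg
  ⊕-isAbelianGroup n = record
    { isGroup = record
      { isMonoid = record
        { isSemigroup = record
          { isMagma = record { isEquivalence = isEquivalence ; ∙-cong = cong₂ _⊕_ }
          ; assoc = Vec.zipWith-assoc +-assoc }
        ; identity = Vec.zipWith-identityˡ +-identityˡ , Vec.zipWith-identityʳ +-identityʳ }
      ; inverse = (λ v → trans (Vec.zipWith-comm +-comm (neg v) v) (⊖-inverseʳ v)) , ⊖-inverseʳ
      ; ⁻¹-cong = cong neg }
    ; comm = Vec.zipWith-comm +-comm }

  ⊕-abelianGroup : ℕ → AbelianGroup 0ℓ 0ℓ
  ⊕-abelianGroup n = record { isAbelianGroup = ⊕-isAbelianGroup n }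

  module ⊕ {n : ℕ} where
    open AbelianGroup (⊕-abelianGroup n) public using (assoc; identityˡ; identityʳ)
    open AbelianGroupProperties (⊕-abelianGroup n) public using (xyx⁻¹≈y; x∙y⁻¹≈ε⇒x≈y)
    open CommutativeSemigroupProperties (AbelianGroup.commutativeSemigroup (⊕-abelianGroup n))
      public using (interchange)

  ⊖-identityʳ : ∀ {n} (v : V n) → v ⊖ 0v ≡ v
  ⊖-identityʳ v = trans (cong (v ⊕_) (·-zeroʳ _)) (⊕.identityʳ v)

  ⊕-⊖-cancel : ∀ {n} (u v : V n) → u ⊕ (v ⊖ u) ≡ v
  ⊕-⊖-cancel u v = trans (sym (⊕.assoc u v (neg u))) (⊕.xyx⁻¹≈y u v)

  ∷-⊖-· : ∀ {n} {c x y} (r u : V n) → c * x ≡ y → (y ∷ u) ⊖ c · (x ∷ r) ≡ ι (u ⊖ c · r)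
  ∷-⊖-· {c = c} {x} {y} r u cx≡y = cong (_∷ u ⊖ c · r) (begin
    y + (- 1#) * (c * x)   ≡⟨ cong (λ t → y + (- 1#) * t) cx≡y ⟩
    y + (- 1#) * y         ≡⟨ cong (y +_) (-1*x≈-x y) ⟩
    y + - y                ≡⟨ -‿inverseʳ y ⟩
    0#                     ∎)
    where open ≡-Reasoning

  cons-split : ∀ {n} b (x : V n) → b ∷ x ≡ (b · tip) ⊕ ι x
  cons-split b x = sym (cong₂ _∷_ (trans (+-identityʳ _) (*-identityʳ b))
                                  (trans (cong (_⊕ x) (·-zeroʳ b)) (⊕.identityˡ x)))

  ·-cancel : ∀ {n} {a} {v : V n} → ¬ a ≡ 0# → a · v ≡ 0v → v ≡ 0v
  ·-cancel {a = a} {v} a≢0 av≡0 = begin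
    v                        ≡⟨ sym (·-identityˡ v) ⟩
    1# · v                   ≡⟨ cong (_· v) (sym (⁻¹-inverseˡ a a≢0)) ⟩
    (a ⁻¹⟨ a≢0 ⟩ * a) · v    ≡⟨ ·-assoc _ a v ⟩
    a ⁻¹⟨ a≢0 ⟩ · (a · v)    ≡⟨ cong (a ⁻¹⟨ a≢0 ⟩ ·_) av≡0 ⟩
    a ⁻¹⟨ a≢0 ⟩ · 0v         ≡⟨ ·-zeroʳ _ ⟩
    0v                       ∎
    where open ≡-Reasoning

  ·≡0⇒scalar≡0 : ∀ {n} {a} {v : V n} → ¬ v ≡ 0v → a · v ≡ 0v → a ≡ 0#
  ·≡0⇒scalar≡0 {a = a} v≢0 av≡0 =
    Dec.decidable-stable (a ≟ 0#) λ a≢0 → v≢0 (·-cancel a≢0 av≡0)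

  tip≢0 : ∀ {n} → ¬ tip {n} ≡ 0v
  tip≢0 = 0≢1 ∘ sym ∘ cong head

  head-tail≡0 : ∀ {n} (c : V (suc n)) → head c ≡ 0# → tail c ≡ 0v → c ≡ 0v
  head-tail≡0 (_ ∷ _) refl refl = refl

  scale-to-tip : ∀ {n} (c : V (suc n)) (head≢0 : ¬ head c ≡ 0#) → tail c ≡ 0v →
                 head c ⁻¹⟨ head≢0 ⟩ · c ≡ tip
  scale-to-tip (x ∷ _) x≢0 refl = cong₂ _∷_ (⁻¹-inverseˡ x x≢0) (·-zeroʳ _)

  -- Linear maps, frames and parametrised subspaces

  module _ {k n : ℕ} {f : V k → V n} (f-linear : IsLinear f) where
    open IsLinear f-linear

    linear-0 : f 0v ≡ 0v
    linear-0 = trans (cong f (sym (·-zeroˡ 0v))) (trans (homogeneous 0# 0v) (·-zeroˡ _))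

    linear-⊖ : ∀ u v → f (u ⊖ v) ≡ f u ⊖ f v
    linear-⊖ u v = trans (additive u (neg v)) (cong (f u ⊕_) (homogeneous (- 1#) v))

    trivial-kernel⇒injective : (∀ v → f v ≡ 0v → v ≡ 0v) → InjectiveMap f
    trivial-kernel⇒injective trivial u v fu≡fv = ⊕.x∙y⁻¹≈ε⇒x≈y u v (trivial (u ⊖ v) (begin
      f (u ⊖ v)   ≡⟨ linear-⊖ u v ⟩
      f u ⊖ f v   ≡⟨ cong (_⊖ f v) fu≡fv ⟩
      f v ⊖ f v   ≡⟨ ⊖-inverseʳ (f v) ⟩
      0v          ∎))
      where open ≡-Reasoning

    injective⇒trivial-kernel : InjectiveMap f → ∀ v → f v ≡ 0v → v ≡ 0v
    injective⇒trivial-kernel injective v fv≡0 = injective v 0v (trans fv≡0 (sym linear-0))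

    injective⇒≡0⇔≡0 : InjectiveMap f → ∀ v → (f v ≡ 0v) ⇔ (v ≡ 0v)
    injective⇒≡0⇔≡0 injective v =
      mk⇔ (injective⇒trivial-kernel injective v) (λ v≡0 → trans (cong f v≡0) linear-0)

  linear-cons : ∀ {k n} {f : V (suc k) → V n} → IsLinear f →
                ∀ b x → f (b ∷ x) ≡ (b · f tip) ⊕ f (ι x)
  linear-cons {f = f} f-linear b x = begin
    f (b ∷ x)               ≡⟨ cong f (cons-split b x) ⟩
    f ((b · tip) ⊕ ι x)     ≡⟨ additive (b · tip) (ι x) ⟩
    f (b · tip) ⊕ f (ι x)   ≡⟨ cong (_⊕ f (ι x)) (homogeneous b tip) ⟩
    (b · f tip) ⊕ f (ι x)   ∎
    where open ≡-Reasoning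
          open IsLinear f-linear

  id-linear : ∀ {n} → IsLinear (id {A = V n})
  id-linear = record { additive = λ _ _ → refl ; homogeneous = λ _ _ → refl }

  ∘-linear : ∀ {k m n} {f : V k → V m} {g : V m → V n} →
             IsLinear f → IsLinear g → IsLinear (g ∘ f)
  ∘-linear {f = f} {g} f-linear g-linear = record
    { additive = λ u v → trans (cong g (F.additive u v)) (G.additive (f u) (f v))
    ; homogeneous = λ a v → trans (cong g (F.homogeneous a v)) (G.homogeneous a (f v)) }
    where module F = IsLinear f-linear
          module G = IsLinear g-linear

  ∘-injective : ∀ {k m n} {f : V k → V m} {g : V m → V n} →
                InjectiveMap f → InjectiveMap g → InjectiveMap (g ∘ f)
  ∘-injective f-injective g-injective u v = f-injective u v ∘ g-injective _ _

  tail-linear : ∀ {n} → IsLinear (tail {n = n})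
  tail-linear = record { additive = λ { (_ ∷ _) (_ ∷ _) → refl }
                       ; homogeneous = λ { _ (_ ∷ _) → refl } }

  ι-linear : ∀ {n} → IsLinear (ι {n})
  ι-linear = record { additive = λ u v → cong (_∷ (u ⊕ v)) (sym (+-identityˡ 0#))
                    ; homogeneous = λ a v → cong (_∷ (a · v)) (sym (zeroʳ a)) }

  ι-injective : ∀ {n} → InjectiveMap (ι {n})
  ι-injective _ _ refl = refl

  factor-linear : ∀ {k m n} {φ : V k → V m} {g : V n → V k} {h : V n → V m} →
                  IsLinear φ → InjectiveMap φ → IsLinear h → (∀ y → φ (g y) ≡ h y) →
                  IsLinear g
  factor-linear {φ = φ} {g} {h} φ-linear φ-injective h-linear φ∘g≗h = record
    { additive = λ u v → φ-injective _ _ (begin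
        φ (g (u ⊕ v))       ≡⟨ φ∘g≗h (u ⊕ v) ⟩
        h (u ⊕ v)           ≡⟨ H.additive u v ⟩
        h u ⊕ h v           ≡⟨ sym (cong₂ _⊕_ (φ∘g≗h u) (φ∘g≗h v)) ⟩
        φ (g u) ⊕ φ (g v)   ≡⟨ sym (Φ.additive (g u) (g v)) ⟩
        φ (g u ⊕ g v)       ∎)
    ; homogeneous = λ a v → φ-injective _ _ (begin
        φ (g (a · v))       ≡⟨ φ∘g≗h (a · v) ⟩
        h (a · v)           ≡⟨ H.homogeneous a v ⟩
        a · h v             ≡⟨ sym (cong (a ·_) (φ∘g≗h v)) ⟩
        a · φ (g v)         ≡⟨ sym (Φ.homogeneous a (g v)) ⟩
        φ (a · g v)         ∎) }
    where module Φ = IsLinear φ-linear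
          module H = IsLinear h-linear
          open ≡-Reasoning

  adjoin : ∀ {d m} → V m → (V d → V m) → V (suc d) → V m
  adjoin w β (b ∷ z) = (b · w) ⊕ β z

  module _ {d m : ℕ} (w : V m) {β : V d → V m} where

    adjoin-linear : IsLinear β → IsLinear (adjoin w β)
    adjoin-linear β-linear = record
      { additive = λ { (b ∷ y) (c ∷ z) → begin
          ((b + c) · w) ⊕ β (y ⊕ z)           ≡⟨ cong₂ _⊕_ (·-distribʳ b c w) (B.additive y z) ⟩
          ((b · w) ⊕ (c · w)) ⊕ (β y ⊕ β z)   ≡⟨ ⊕.interchange (b · w) (c · w) (β y) (β z) ⟩
          ((b · w) ⊕ β y) ⊕ ((c · w) ⊕ β z)   ∎ }
      ; homogeneous = λ { a (b ∷ z) → begin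
          ((a * b) · w) ⊕ β (a · z)           ≡⟨ cong₂ _⊕_ (·-assoc a b w) (B.homogeneous a z) ⟩
          (a · (b · w)) ⊕ (a · β z)           ≡⟨ sym (·-distribˡ a (b · w) (β z)) ⟩
          a · ((b · w) ⊕ β z)                 ∎ } }
      where module B = IsLinear β-linear
            open ≡-Reasoning

    adjoin-tip : IsLinear β → adjoin w β tip ≡ w
    adjoin-tip β-linear =
      trans (cong₂ _⊕_ (·-identityˡ w) (linear-0 β-linear)) (⊕.identityʳ w)

    adjoin-hits : ∀ c z {v} → β z ≡ v ⊖ (c · w) → adjoin w β (c ∷ z) ≡ v
    adjoin-hits c z {v} βz≡v-cw = trans (cong ((c · w) ⊕_) βz≡v-cw) (⊕-⊖-cancel (c · w) v)

  adjoin-ι-injective : ∀ {d m x} {r : V m} {β : V d → V m} → ¬ x ≡ 0# →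
                       IsLinear β → InjectiveMap β → InjectiveMap (adjoin (x ∷ r) (ι ∘ β))
  adjoin-ι-injective {x = x} {r} {β} x≢0 β-linear β-injective =
    trivial-kernel⇒injective (adjoin-linear (x ∷ r) (∘-linear β-linear ι-linear)) trivial
    where
      trivial : ∀ c → adjoin (x ∷ r) (ι ∘ β) c ≡ 0v → c ≡ 0v
      trivial (b ∷ z) image≡0 with Vec.∷-injective image≡0
      ... | bx+0≡0 , br+βz≡0
          with x*y≡0⇒y≡0 x≢0 (trans (*-comm x b) (trans (sym (+-identityʳ _)) bx+0≡0))
      ... | refl = cong ι (injective⇒trivial-kernel β-linear β-injective z (begin
              β z                 ≡⟨ sym (⊕.identityˡ (β z)) ⟩
              0v ⊕ β z            ≡⟨ cong (_⊕ β z) (sym (·-zeroˡ r)) ⟩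
              (0# · r) ⊕ β z      ≡⟨ br+βz≡0 ⟩
              0v                  ∎))
        where open ≡-Reasoning

  record Frame {m : ℕ} (w : V m) : Set where
    field
      d            : ℕ
      J            : V (suc d) → V m
      J-linear     : IsLinear J
      J-injective  : InjectiveMap J
      J-surjective : ∀ v → ∃ λ c → J c ≡ v
      J-tip        : J tip ≡ w

    K : V m → V (suc d)
    K v = proj₁ (J-surjective v)

    J∘K : ∀ v → J (K v) ≡ v
    J∘K v = proj₂ (J-surjective v)

    K∘J : ∀ c → K (J c) ≡ c
    K∘J c = J-injective _ _ (J∘K (J c))

    K-linear : IsLinear K
    K-linear = factor-linear J-linear J-injective id-linear J∘K

    K-injective : InjectiveMap K
    K-injective u v Ku≡Kv = trans (sym (J∘K u)) (trans (cong J Ku≡Kv) (J∘K v))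

    K-tip : K w ≡ tip
    K-tip = trans (cong K (sym J-tip)) (K∘J tip)

  shear-frame : ∀ {m x} → ¬ x ≡ 0# → (r : V m) → Frame (x ∷ r)
  shear-frame {x = x} x≢0 r = record
    { J = adjoin (x ∷ r) ι
    ; J-linear = adjoin-linear (x ∷ r) ι-linear
    ; J-injective = adjoin-ι-injective x≢0 id-linear (λ _ _ → id)
    ; J-surjective = λ { (y ∷ u) → let c = y * x ⁻¹⟨ x≢0 ⟩ in
        c ∷ u ⊖ (c · r) ,
        adjoin-hits (x ∷ r) {β = ι} c _ (sym (∷-⊖-· r u (*-⁻¹-cancelʳ x≢0 y))) }
    ; J-tip = adjoin-tip (x ∷ r) ι-linear }

  swap-frame : ∀ {m} {r : V m} → Frame r → Frame (0# ∷ r)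
  swap-frame {m} {r} frame = record
    { J = J′
    ; J-linear = record
      { additive = λ { (b ∷ c ∷ y) (b′ ∷ c′ ∷ z) →
          cong ((c + c′) ∷_) (additive (b ∷ y) (b′ ∷ z)) }
      ; homogeneous = λ { a (b ∷ c ∷ z) → cong ((a * c) ∷_) (homogeneous a (b ∷ z)) } }
    ; J-injective = λ { (b ∷ c ∷ y) (b′ ∷ c′ ∷ z) J′≡J′ →
        let c≡c′ , J≡J = Vec.∷-injective J′≡J′ in injective c≡c′ (J-injective _ _ J≡J) }
    ; J-surjective = λ { (c ∷ u) → surjective c (J-surjective u) }
    ; J-tip = cong ι J-tip }
    where
      open Frame frame
      open IsLinear J-linear
      J′ : V (suc (suc d)) → V (suc m)
      J′ (b ∷ c ∷ z) = c ∷ J (b ∷ z)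
      injective : ∀ {b c y b′ c′ z} → c ≡ c′ → b ∷ y ≡ b′ ∷ z → b ∷ c ∷ y ≡ b′ ∷ c′ ∷ z
      injective refl refl = refl
      surjective : ∀ c {u} → (∃ λ e → J e ≡ u) → ∃ λ e → J′ e ≡ c ∷ u
      surjective c (b ∷ z , J[b∷z]≡u) = b ∷ c ∷ z , cong (c ∷_) J[b∷z]≡u

  frame : ∀ {m} (w : V m) → ¬ w ≡ 0v → Frame w
  frame [] w≢0 = ⊥-elim (w≢0 refl)
  frame (x ∷ r) w≢0 with x ≟ 0#
  ... | no x≢0 = shear-frame x≢0 r
  ... | yes refl = swap-frame (frame r (w≢0 ∘ cong ι))

  record Subspace (m : ℕ) : Set₁ where
    field
      Member   : V m → Set
      member?  : ∀ v → Dec (Member v)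
      0-member : Member 0v
      ⊕-closed : ∀ {u v} → Member u → Member v → Member (u ⊕ v)
      ·-closed : ∀ a {v} → Member v → Member (a · v)

  preimage : ∀ {k n} {f : V k → V n} → IsLinear f → Subspace n → Subspace k
  preimage {f = f} f-linear S = record
    { Member = Member ∘ f
    ; member? = member? ∘ f
    ; 0-member = subst Member (sym (linear-0 f-linear)) 0-member
    ; ⊕-closed = λ {u} {v} fu∈S fv∈S → subst Member (sym (additive u v)) (⊕-closed fu∈S fv∈S)
    ; ·-closed = λ a {v} fv∈S → subst Member (sym (homogeneous a v)) (·-closed a fv∈S) }
    where open Subspace S
          open IsLinear f-linear

  image : ∀ {k n} {f : V k → V n} → IsLinear f → Subspace n
  image {k} {f = f} f-linear = record
    { Member = λ w → ∃ λ v → f v ≡ w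
    ; member? = λ w → Vec-searchable Carrier-searchable k _ (λ v → Vec.≡-dec _≟_ (f v) w)
    ; 0-member = 0v , linear-0 f-linear
    ; ⊕-closed = λ (u , fu≡u′) (v , fv≡v′) →
        u ⊕ v , trans (additive u v) (cong₂ _⊕_ fu≡u′ fv≡v′)
    ; ·-closed = λ a (v , fv≡v′) → a · v , trans (homogeneous a v) (cong (a ·_) fv≡v′) }
    where open IsLinear f-linear

  record Parametrisation {m : ℕ} (S : Subspace m) : Set where
    field
      d            : ℕ
      β            : V d → V m
      β-linear     : IsLinear β
      β-injective  : InjectiveMap β
      β-member     : ∀ y → Subspace.Member S (β y)
      β-surjective : ∀ v → Subspace.Member S v → ∃ λ y → β y ≡ v

  module _ {m : ℕ} (S : Subspace (suc m)) (P : Parametrisation (preimage ι-linear S)) where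
    open Subspace S
    open Parametrisation P

    parametrisation-in-hyperplane : (∀ v → Member v → head v ≡ 0#) → Parametrisation S
    parametrisation-in-hyperplane in-hyperplane = record
      { β = ι ∘ β
      ; β-linear = ∘-linear β-linear ι-linear
      ; β-injective = ∘-injective β-injective ι-injective
      ; β-member = β-member
      ; β-surjective = λ { (x ∷ u) x∷u∈S → hit (in-hyperplane _ x∷u∈S) x∷u∈S } }
      where
        hit : ∀ {x u} → x ≡ 0# → Member (x ∷ u) → ∃ λ y → ι (β y) ≡ x ∷ u
        hit refl ιu∈S = let y , βy≡u = β-surjective _ ιu∈S in y , cong ι βy≡u

    parametrisation-adjoin : ∀ {x r} → ¬ x ≡ 0# → Member (x ∷ r) → Parametrisation S
    parametrisation-adjoin {x} {r} x≢0 x∷r∈S = record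
      { β = adjoin (x ∷ r) (ι ∘ β)
      ; β-linear = adjoin-linear (x ∷ r) (∘-linear β-linear ι-linear)
      ; β-injective = adjoin-ι-injective x≢0 β-linear β-injective
      ; β-member = λ { (b ∷ y) → ⊕-closed (·-closed b x∷r∈S) (β-member y) }
      ; β-surjective = λ { (y ∷ u) y∷u∈S → hit y∷u∈S } }
      where
        hit : ∀ {y u} → Member (y ∷ u) → ∃ λ e → adjoin (x ∷ r) (ι ∘ β) e ≡ y ∷ u
        hit {y} {u} y∷u∈S =
          let c = y * x ⁻¹⟨ x≢0 ⟩
              shifted = ∷-⊖-· r u (*-⁻¹-cancelʳ x≢0 y)
              z , βz≡u-cr = β-surjective (u ⊖ (c · r)) (subst Member shifted
                              (⊕-closed y∷u∈S (·-closed (- 1#) (·-closed c x∷r∈S))))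
          in c ∷ z , adjoin-hits (x ∷ r) {β = ι ∘ β} c z (trans (cong ι βz≡u-cr) (sym shifted))

  parametrise : ∀ {m} (S : Subspace m) → Parametrisation S
  parametrise {zero} S = record
    { β = id ; β-linear = id-linear ; β-injective = λ _ _ → id
    ; β-member = λ { [] → Subspace.0-member S } ; β-surjective = λ v _ → v , refl }
  parametrise {suc m} S
    with Vec-searchable Carrier-searchable (suc m) _
           (λ v → Subspace.member? S v Dec.×-dec Dec.¬? (head v ≟ 0#))
  ... | yes (x ∷ r , x∷r∈S , x≢0) =
    parametrisation-adjoin S (parametrise (preimage ι-linear S)) x≢0 x∷r∈S
  ... | no ∄ = parametrisation-in-hyperplane S (parametrise (preimage ι-linear S))
    λ v v∈S → Dec.decidable-stable (head v ≟ 0#) λ head≢0 → ∄ (v , v∈S , head≢0)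

  -- Represented matroids and their equivalences

  Image : (M : RepMatroid) {n : ℕ} → (V (dim M) → V n) → V n → Set
  Image M ψ w = ∃ λ v → pts M v × ψ v ≡ w

  Image-∘ : ∀ {A X : RepMatroid} {n} {χ : V (dim A) → V (dim X)} {ψ : V (dim X) → V n} →
            (∀ x → pts X x ⇔ Image A χ x) → ∀ w → Image X ψ w ⇔ Image A (ψ ∘ χ) w
  Image-∘ {χ = χ} {ψ} X≡χA w = mk⇔
    (λ (x , x∈X , ψx≡w) → let a , a∈A , χa≡x = to (X≡χA x) x∈X in
                            a , a∈A , trans (cong ψ χa≡x) ψx≡w)
    (λ (a , a∈A , ψχa≡w) → χ a , from (X≡χA (χ a)) (a , a∈A , refl) , ψχa≡w)

  pullback : (N : RepMatroid) {d : ℕ} {β : V d → V (dim N)} →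
             IsLinear β → InjectiveMap β → RepMatroid
  pullback N {d} {β} β-linear β-injective = record
    { dim = d
    ; pts = pts N ∘ β
    ; nonzero = λ v βv∈N v≡0 → nonzero N (β v) βv∈N (trans (cong β v≡0) (linear-0 β-linear))
    ; scaled = λ a v a≢0 βv∈N →
        subst (pts N) (sym (IsLinear.homogeneous β-linear a v)) (scaled N a (β v) a≢0 βv∈N) }

  pushforward : (N : RepMatroid) {n : ℕ} {f : V (dim N) → V n} → IsLinear f → RepMatroid
  pushforward N {n} {f} f-linear = record
    { dim = n
    ; pts = λ w → ¬ w ≡ 0v × Image N f w
    ; nonzero = λ _ → proj₁
    ; scaled = λ { a w a≢0 (w≢0 , v , v∈N , fv≡w) →
        w≢0 ∘ ·-cancel a≢0 , a · v , scaled N a v a≢0 v∈N ,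
        trans (IsLinear.homogeneous f-linear a v) (cong (a ·_) fv≡w) } }

  pushforward-Frame : ∀ {m} {w : V m} (fr : Frame w) {M : RepMatroid} {ψ : V (dim M) → V m}
                      (ψ-linear : IsLinear ψ) → let open Frame fr in
                      ∀ c → pts (pushforward M ψ-linear) (J c)
                          ⇔ pts (pushforward M (∘-linear ψ-linear K-linear)) c
  pushforward-Frame fr ψ-linear c =
    mk⇔ (λ Jc≢0 → Jc≢0 ∘ from J≡0⇔≡0) (λ c≢0 → c≢0 ∘ to J≡0⇔≡0) ×-⇔
    mk⇔ (λ (v , v∈M , ψv≡Jc) → v , v∈M , trans (cong K ψv≡Jc) (K∘J c))
        (λ (v , v∈M , Kψv≡c) → v , v∈M , trans (sym (J∘K _)) (cong J Kψv≡c))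
    where open Frame fr
          J≡0⇔≡0 = injective⇒≡0⇔≡0 J-linear J-injective c

  bijection-Equivalent : ∀ {C Y} {J : V (dim C) → V (dim Y)} →
                         IsLinear J → InjectiveMap J → (∀ v → ∃ λ c → J c ≡ v) →
                         (∀ c → pts Y (J c) ⇔ pts C c) → Equivalent C Y
  bijection-Equivalent {C} {Y} {J} J-linear J-injective J-surjective Y∘J≡C =
    J , J-linear , J-injective , λ w → mk⇔
      (λ w∈Y → let c , Jc≡w = J-surjective w in
               c , to (Y∘J≡C c) (subst (pts Y) (sym Jc≡w) w∈Y) , Jc≡w)
      (λ (c , c∈C , Jc≡w) → subst (pts Y) Jc≡w (from (Y∘J≡C c) c∈C))

  Equivalent-refl : ∀ M → Equivalent M M
  Equivalent-refl M = id , id-linear , (λ _ _ → id) ,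
    λ w → mk⇔ (λ w∈M → w , w∈M , refl) (λ { (w , w∈M , refl) → w∈M })

  Equivalent-trans : ∀ {A B C} → Equivalent A B → Equivalent B C → Equivalent A C
  Equivalent-trans {A} {B} (χ , χ-linear , χ-injective , B≡χA)
                           (ψ , ψ-linear , ψ-injective , C≡ψB) =
    ψ ∘ χ , ∘-linear χ-linear ψ-linear , ∘-injective χ-injective ψ-injective ,
    λ w → ⇔-trans (C≡ψB w) (Image-∘ {A} {B} B≡χA w)

  Equivalent⇒Step : ∀ {M N} → Equivalent M N → Step M N
  Equivalent⇒Step (ψ , ψ-linear , ψ-injective , N≡ψM) = reembed ψ ψ-linear ψ-injective N≡ψM

  span-preimage : ∀ {k n} {χ : V k → V n} → IsLinear χ → InjectiveMap χ →
                  ∀ {e₀ e} → χ e₀ ≡ e → ∀ v → (∃ λ a → χ v ≡ a · e) ⇔ (∃ λ a → v ≡ a · e₀)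
  span-preimage {χ = χ} χ-linear χ-injective {e₀} {e} χe₀≡e v = mk⇔
    (λ (a , χv≡ae) → a , χ-injective _ _ (trans χv≡ae (sym χ[ae₀]≡ae)))
    (λ (a , v≡ae₀) → a , trans (cong χ v≡ae₀) χ[ae₀]≡ae)
    where
      χ[ae₀]≡ae : ∀ {a} → χ (a · e₀) ≡ a · e
      χ[ae₀]≡ae {a} = trans (IsLinear.homogeneous χ-linear a e₀) (cong (a ·_) χe₀≡e)

  -- χ need not be onto, so the flat is pulled back to A through a parametrisation of
  -- χ⁻¹(im φ).
  restriction-along-Equivalent :
    ∀ {A X Y} → Equivalent A X →
    (φ : V (dim Y) → V (dim X)) → IsLinear φ → InjectiveMap φ →
    (∀ v → pts Y v ⇔ pts X (φ v)) → ∃ λ Y′ → Step A Y′ × Equivalent Y′ Y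
  restriction-along-Equivalent {A} {X} {Y} (χ , χ-linear , χ-injective , X≡χA)
                               φ φ-linear φ-injective Y≡φ⁻¹X =
    pullback A β-linear β-injective , restrict β β-linear β-injective (λ _ → ⇔-refl) ,
    g , g-linear , g-injective , λ w → mk⇔ (into w) (out w)
    where
      open Parametrisation (parametrise (preimage χ-linear (image φ-linear)))
      g : V d → V (dim Y)
      g y = proj₁ (β-member y)
      φ∘g≗χ∘β : ∀ y → φ (g y) ≡ χ (β y)
      φ∘g≗χ∘β y = proj₂ (β-member y)
      g-linear : IsLinear g
      g-linear = factor-linear φ-linear φ-injective (∘-linear β-linear χ-linear) φ∘g≗χ∘β
      g-injective : InjectiveMap g
      g-injective y y′ gy≡gy′ = β-injective y y′ (χ-injective _ _
        (trans (sym (φ∘g≗χ∘β y)) (trans (cong φ gy≡gy′) (φ∘g≗χ∘β y′))))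
      into : ∀ w → pts Y w → Image (pullback A β-linear β-injective) g w
      into w w∈Y =
        let a , a∈A , χa≡φw = to (X≡χA (φ w)) (to (Y≡φ⁻¹X w) w∈Y)
            y , βy≡a = β-surjective a (w , sym χa≡φw)
        in y , subst (pts A) (sym βy≡a) a∈A ,
           φ-injective _ _ (trans (φ∘g≗χ∘β y) (trans (cong χ βy≡a) χa≡φw))
      out : ∀ w → Image (pullback A β-linear β-injective) g w → pts Y w
      out w (y , βy∈A , gy≡w) = from (Y≡φ⁻¹X w) (from (X≡χA (φ w))
        (β y , βy∈A , trans (sym (φ∘g≗χ∘β y)) (cong φ gy≡w)))

  step-along-Equivalent : ∀ {A X Y} → Equivalent A X → Step X Y →
                          ∃ λ Y′ → Step A Y′ × Equivalent Y′ Y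
  step-along-Equivalent {A} {X} {Y} A≅X (restrict φ φ-linear φ-injective Y≡φ⁻¹X) =
    restriction-along-Equivalent {A} {X} {Y} A≅X φ φ-linear φ-injective Y≡φ⁻¹X
  step-along-Equivalent {A} {X} {Y} A≅X (reembed ψ ψ-linear ψ-injective Y≡ψX) =
    Y , Equivalent⇒Step {A} (Equivalent-trans {A} {X} {Y} A≅X X≅Y) , Equivalent-refl Y
    where X≅Y = ψ , ψ-linear , ψ-injective , Y≡ψX
  step-along-Equivalent {A} {X} {Y} (χ , χ-linear , χ-injective , X≡χA)
                        (contract e e∈X ψ ψ-linear kerψ Y≡ψX∖0) =
    let e₀ , e₀∈A , χe₀≡e = to (X≡χA e) e∈X in
    Y , contract e₀ e₀∈A (ψ ∘ χ) (∘-linear χ-linear ψ-linear)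
          (λ v → ⇔-trans (kerψ (χ v)) (span-preimage χ-linear χ-injective χe₀≡e v))
          (λ w → ⇔-trans (Y≡ψX∖0 w) (⇔-refl ×-⇔ Image-∘ {A} {X} X≡χA w)) ,
    Equivalent-refl Y

  -- Induced minors of a cone

  subst-⇔ : ∀ {A : Set} (P : A → Set) {x y} → x ≡ y → P x ⇔ P y
  subst-⇔ P x≡y = mk⇔ (subst P x≡y) (subst P (sym x≡y))

  cone-pts : ∀ M c → pts (cone M) c ⇔ ((tail c ≡ 0v × ¬ head c ≡ 0#) ⊎ pts M (tail c))
  cone-pts M (_ ∷ _) = ⇔-refl

  cone-tip-line : ∀ M b → pts (cone M) (b ∷ 0v) ⇔ (¬ b ≡ 0#)
  cone-tip-line M b = mk⇔
    (λ { (inj₁ (_ , b≢0)) → b≢0 ; (inj₂ 0∈M) → ⊥-elim (nonzero M 0v 0∈M refl) })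
    (λ b≢0 → inj₁ (refl , b≢0))

  cone-off-tip-line : ∀ M b {x} → ¬ x ≡ 0v → pts (cone M) (b ∷ x) ⇔ pts M x
  cone-off-tip-line M b x≢0 =
    mk⇔ (λ { (inj₁ (x≡0 , _)) → ⊥-elim (x≢0 x≡0) ; (inj₂ x∈M) → x∈M }) inj₂

  -- A linear map fixing the tip induces, modulo the tip, a map between the hyperplanes x₀ = 0
  -- (its shadow), and it carries the cone over N to the cone over the shadow of N.
  module TipFixing {k n : ℕ} {Θ : V (suc k) → V (suc n)}
                   (Θ-linear : IsLinear Θ) (Θ-tip : Θ tip ≡ tip) where

    shadow : V k → V n
    shadow = tail ∘ Θ ∘ ι

    shadow-linear : IsLinear shadow
    shadow-linear = ∘-linear (∘-linear ι-linear Θ-linear) tail-linear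

    Θ-tip-line : ∀ b → Θ (b ∷ 0v) ≡ b ∷ 0v
    Θ-tip-line b = begin
      Θ (b ∷ 0v)    ≡⟨ cong Θ (sym (·-tip b)) ⟩
      Θ (b · tip)   ≡⟨ IsLinear.homogeneous Θ-linear b tip ⟩
      b · Θ tip     ≡⟨ cong (b ·_) Θ-tip ⟩
      b · tip       ≡⟨ ·-tip b ⟩
      b ∷ 0v        ∎
      where open ≡-Reasoning

    Θ-cons : ∀ b z → Θ (b ∷ z) ≡ (b + head (Θ (ι z))) ∷ shadow z
    Θ-cons b z = begin
      Θ (b ∷ z)                         ≡⟨ linear-cons Θ-linear b z ⟩
      (b · Θ tip) ⊕ Θ (ι z)             ≡⟨ cong (λ t → (b · t) ⊕ Θ (ι z)) Θ-tip ⟩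
      (b · tip) ⊕ Θ (ι z)               ≡⟨ cong (_⊕ Θ (ι z)) (·-tip b) ⟩
      (b ∷ 0v) ⊕ Θ (ι z)                ≡⟨ ∷0⊕ (Θ (ι z)) ⟩
      (b + head (Θ (ι z))) ∷ shadow z   ∎
      where
        open ≡-Reasoning
        ∷0⊕ : (c : V (suc n)) → (b ∷ 0v) ⊕ c ≡ (b + head c) ∷ tail c
        ∷0⊕ (h ∷ t) = cong ((b + h) ∷_) (⊕.identityˡ t)

    tail-Θ : ∀ b z → tail (Θ (b ∷ z)) ≡ shadow z
    tail-Θ b z = cong tail (Θ-cons b z)

    shadow≡0⇒tip-line : ∀ z → shadow z ≡ 0v → Θ (ι z) ≡ Θ (head (Θ (ι z)) ∷ 0v)
    shadow≡0⇒tip-line z shadow≡0 with Θ (ι z)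
    ... | h ∷ t = trans (cong (h ∷_) shadow≡0) (sym (Θ-tip-line h))

    shadow-injective : InjectiveMap Θ → InjectiveMap shadow
    shadow-injective Θ-injective = trivial-kernel⇒injective shadow-linear λ z shadow≡0 →
      cong tail (Θ-injective _ _ (shadow≡0⇒tip-line z shadow≡0))

    shadow-kernel : ∀ {a u} → (∀ v → (Θ v ≡ 0v) ⇔ (∃ λ c → v ≡ c · (a ∷ u))) →
                    ∀ x → (shadow x ≡ 0v) ⇔ (∃ λ c → x ≡ c · u)
    shadow-kernel {a} {u} kerΘ x = mk⇔ into out
      where
        open ≡-Reasoning
        into : shadow x ≡ 0v → ∃ λ c → x ≡ c · u
        into shadow≡0 =
          let h = head (Θ (ι x))
              c , ιx-h∷0≡c[a∷u] = to (kerΘ (ι x ⊖ (h ∷ 0v))) (begin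
                Θ (ι x ⊖ (h ∷ 0v))          ≡⟨ linear-⊖ Θ-linear (ι x) (h ∷ 0v) ⟩
                Θ (ι x) ⊖ Θ (h ∷ 0v)
                  ≡⟨ cong (_⊖ Θ (h ∷ 0v)) (shadow≡0⇒tip-line x shadow≡0) ⟩
                Θ (h ∷ 0v) ⊖ Θ (h ∷ 0v)     ≡⟨ ⊖-inverseʳ (Θ (h ∷ 0v)) ⟩
                0v                          ∎)
          in c , trans (sym (⊖-identityʳ x)) (cong tail ιx-h∷0≡c[a∷u])
        shadow-u≡0 : shadow u ≡ 0v
        shadow-u≡0 =
          trans (sym (tail-Θ a u)) (cong tail (from (kerΘ _) (1# , sym (·-identityˡ _))))
        out : (∃ λ c → x ≡ c · u) → shadow x ≡ 0v
        out (c , x≡cu) = begin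
          shadow x         ≡⟨ cong shadow x≡cu ⟩
          shadow (c · u)   ≡⟨ IsLinear.homogeneous shadow-linear c u ⟩
          c · shadow u     ≡⟨ cong (c ·_) shadow-u≡0 ⟩
          c · 0v           ≡⟨ ·-zeroʳ c ⟩
          0v               ∎

  module _ {N : RepMatroid} {k : ℕ} {Θ : V (suc k) → V (suc (dim N))}
           (Θ-linear : IsLinear Θ) (Θ-tip : Θ tip ≡ tip) (Θ-injective : InjectiveMap Θ) where
    open TipFixing Θ-linear Θ-tip

    shadow-pullback : RepMatroid
    shadow-pullback = pullback N shadow-linear (shadow-injective Θ-injective)

    pullback-cone : ∀ c → pts (pullback (cone N) Θ-linear Θ-injective) c
                        ⇔ pts (cone shadow-pullback) c
    pullback-cone (b ∷ z) with Vec.≡-dec _≟_ z 0v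
    ... | yes refl = ⇔-trans (subst-⇔ (pts (cone N)) (Θ-tip-line b))
                       (⇔-trans (cone-tip-line N b) (⇔-sym (cone-tip-line shadow-pullback b)))
    ... | no z≢0 = ⇔-trans (subst-⇔ (pts (cone N)) (Θ-cons b z))
                     (⇔-trans (cone-off-tip-line N _ (z≢0 ∘ shadow≡0⇒≡0 z))
                              (⇔-sym (cone-off-tip-line shadow-pullback b z≢0)))
      where shadow≡0⇒≡0 = injective⇒trivial-kernel shadow-linear (shadow-injective Θ-injective)

  module _ {N : RepMatroid} {d : ℕ} {Θ : V (suc (dim N)) → V (suc d)}
           (Θ-linear : IsLinear Θ) (Θ-tip : Θ tip ≡ tip) where
    open TipFixing Θ-linear Θ-tip

    shadow-pushforward : RepMatroid
    shadow-pushforward = pushforward N shadow-linear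

    pushforward-cone : ∀ c → pts (pushforward (cone N) Θ-linear) c
                           ⇔ pts (cone shadow-pushforward) c
    pushforward-cone (h ∷ z) with Vec.≡-dec _≟_ z 0v
    ... | yes refl = mk⇔
      (λ (h∷0≢0 , _) → from (cone-tip-line shadow-pushforward h) (h∷0≢0 ∘ cong (_∷ 0v)))
      (λ h∷0∈cone → let h≢0 = to (cone-tip-line shadow-pushforward h) h∷0∈cone in
                    h≢0 ∘ cong head , h ∷ 0v , from (cone-tip-line N h) h≢0 , Θ-tip-line h)
    ... | no z≢0 = ⇔-trans (mk⇔ into out) (⇔-sym (cone-off-tip-line shadow-pushforward h z≢0))
      where
        into : pts (pushforward (cone N) Θ-linear) (h ∷ z) → pts shadow-pushforward z
        into (_ , b ∷ x , b∷x∈cone , Θ[b∷x]≡h∷z) =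
          z≢0 , x , to (cone-off-tip-line N b x≢0) b∷x∈cone , shadow-x≡z
          where
            shadow-x≡z : shadow x ≡ z
            shadow-x≡z = trans (sym (tail-Θ b x)) (cong tail Θ[b∷x]≡h∷z)
            x≢0 : ¬ x ≡ 0v
            x≢0 x≡0 =
              z≢0 (trans (sym shadow-x≡z) (trans (cong shadow x≡0) (linear-0 shadow-linear)))
        out : pts shadow-pushforward z → pts (pushforward (cone N) Θ-linear) (h ∷ z)
        out (_ , x , x∈N , shadow-x≡z) =
          z≢0 ∘ cong tail , (h + - head (Θ (ι x))) ∷ x , inj₂ x∈N ,
          trans (Θ-cons _ x) (cong₂ _∷_ (x-y+y≡x h _) shadow-x≡z)

  data MinorOrConeOfMinor (N Y : RepMatroid) : Set₁ where
    minor         : IsInducedMinor Y N → MinorOrConeOfMinor N Y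
    cone-of-minor : ∀ {N′} → IsInducedMinor N′ N → Equivalent (cone N′) Y →
                    MinorOrConeOfMinor N Y

  module _ {N Y : RepMatroid} (φ : V (dim Y) → V (suc (dim N))) (φ-linear : IsLinear φ)
           (φ-injective : InjectiveMap φ) (Y≡φ⁻¹cone : ∀ v → pts Y v ⇔ pts (cone N) (φ v)) where

    restriction-through-tip : ∀ {v₀} → φ v₀ ≡ tip → MinorOrConeOfMinor N Y
    restriction-through-tip {v₀} φv₀≡tip =
      cone-of-minor {N′ = N′}
        (restrict shadow shadow-linear (shadow-injective Θ-injective) (λ _ → ⇔-refl) ◅ ε)
        (bijection-Equivalent {cone N′} {Y} J-linear J-injective J-surjective λ c →
          ⇔-trans (Y≡φ⁻¹cone (J c)) (pullback-cone Θ-linear Θ-tip Θ-injective c))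
      where
        v₀≢0 : ¬ v₀ ≡ 0v
        v₀≢0 v₀≡0 = tip≢0 (trans (sym φv₀≡tip) (trans (cong φ v₀≡0) (linear-0 φ-linear)))
        open Frame (frame v₀ v₀≢0)
        Θ-linear : IsLinear (φ ∘ J)
        Θ-linear = ∘-linear J-linear φ-linear
        Θ-tip : φ (J tip) ≡ tip
        Θ-tip = trans (cong φ J-tip) φv₀≡tip
        Θ-injective : InjectiveMap (φ ∘ J)
        Θ-injective = ∘-injective J-injective φ-injective
        open TipFixing Θ-linear Θ-tip
        N′ : RepMatroid
        N′ = shadow-pullback {N = N} Θ-linear Θ-tip Θ-injective

    restriction-avoiding-tip : ¬ (∃ λ v → φ v ≡ tip) → Step N Y
    restriction-avoiding-tip ∄v→tip =
      restrict (tail ∘ φ) tail∘φ-linear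
        (trivial-kernel⇒injective tail∘φ-linear λ v tail≡0 →
          injective⇒trivial-kernel φ-linear φ-injective v
            (head-tail≡0 (φ v) (head≡0 v tail≡0) tail≡0))
        λ v → ⇔-trans (Y≡φ⁻¹cone v) (⇔-trans (cone-pts N (φ v)) (mk⇔
          (λ { (inj₁ (tail≡0 , head≢0)) → ⊥-elim (head≢0 (head≡0 v tail≡0)) ; (inj₂ p) → p })
          inj₂))
      where
        tail∘φ-linear = ∘-linear φ-linear tail-linear
        head≡0 : ∀ v → tail (φ v) ≡ 0v → head (φ v) ≡ 0#
        head≡0 v tail≡0 = Dec.decidable-stable (head (φ v) ≟ 0#) λ head≢0 →
          ∄v→tip (_ , trans (IsLinear.homogeneous φ-linear _ v)
                            (scale-to-tip (φ v) head≢0 tail≡0))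

  module _ {N Y : RepMatroid} {a : Carrier} {u : V (dim N)}
           (ψ : V (suc (dim N)) → V (dim Y)) (ψ-linear : IsLinear ψ)
           (kerψ : ∀ v → (ψ v ≡ 0v) ⇔ (∃ λ c → v ≡ c · (a ∷ u)))
           (Y≡ψcone : ∀ w → pts Y w ⇔ pts (pushforward (cone N) ψ-linear) w) where

    contraction-of-tip : ¬ a ≡ 0# → u ≡ 0v → Step N Y
    contraction-of-tip a≢0 refl =
      reembed (ψ ∘ ι) ψι-linear ψι-injective λ w → ⇔-trans (Y≡ψcone w) (mk⇔ into out)
      where
        ψ-tip-line : ∀ b → ψ (b ∷ 0v) ≡ 0v
        ψ-tip-line b = from (kerψ _)
          (b * a ⁻¹⟨ a≢0 ⟩ , cong₂ _∷_ (sym (*-⁻¹-cancelʳ a≢0 b)) (sym (·-zeroʳ _)))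
        ψ-cons : ∀ b x → ψ (b ∷ x) ≡ ψ (ι x)
        ψ-cons b x = begin
          ψ (b ∷ x)               ≡⟨ linear-cons ψ-linear b x ⟩
          (b · ψ tip) ⊕ ψ (ι x)   ≡⟨ cong (λ t → (b · t) ⊕ ψ (ι x)) (ψ-tip-line 1#) ⟩
          (b · 0v) ⊕ ψ (ι x)      ≡⟨ cong (_⊕ ψ (ι x)) (·-zeroʳ b) ⟩
          0v ⊕ ψ (ι x)            ≡⟨ ⊕.identityˡ (ψ (ι x)) ⟩
          ψ (ι x)                 ∎
          where open ≡-Reasoning
        ψι-linear = ∘-linear ι-linear ψ-linear
        ψι-injective : InjectiveMap (ψ ∘ ι)
        ψι-injective = trivial-kernel⇒injective ψι-linear λ z ψιz≡0 →
          let c , ιz≡c[a∷0] = to (kerψ (ι z)) ψιz≡0 in trans (cong tail ιz≡c[a∷0]) (·-zeroʳ c)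
        into : ∀ {w} → pts (pushforward (cone N) ψ-linear) w → Image N (ψ ∘ ι) w
        into (w≢0 , b ∷ x , inj₁ (refl , _) , ψ[b∷0]≡w) =
          ⊥-elim (w≢0 (trans (sym ψ[b∷0]≡w) (ψ-tip-line b)))
        into (w≢0 , b ∷ x , inj₂ x∈N , ψ[b∷x]≡w) = x , x∈N , trans (sym (ψ-cons b x)) ψ[b∷x]≡w
        out : ∀ {w} → Image N (ψ ∘ ι) w → pts (pushforward (cone N) ψ-linear) w
        out (x , x∈N , ψιx≡w) =
          (λ w≡0 → nonzero N x x∈N
                     (injective⇒trivial-kernel ψι-linear ψι-injective x (trans ψιx≡w w≡0))) ,
          ι x , inj₂ x∈N , ψιx≡w

    contraction-off-tip : pts N u → MinorOrConeOfMinor N Y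
    contraction-off-tip u∈N =
      cone-of-minor {N′ = N′}
        (contract u u∈N shadow shadow-linear (shadow-kernel kerΘ) (λ _ → ⇔-refl) ◅ ε)
        (bijection-Equivalent {cone N′} {Y} J-linear J-injective J-surjective λ c →
          ⇔-trans (Y≡ψcone (J c))
            (⇔-trans (pushforward-Frame fr {cone N} ψ-linear c)
                     (pushforward-cone Θ-linear K-tip c)))
      where
        ψ-tip≢0 : ¬ ψ tip ≡ 0v
        ψ-tip≢0 ψ-tip≡0 =
          let c , tip≡c[a∷u] = to (kerψ tip) ψ-tip≡0
              c≡0 = ·≡0⇒scalar≡0 (nonzero N u u∈N) (sym (cong tail tip≡c[a∷u]))
          in 0≢1 (sym (trans (cong head tip≡c[a∷u]) (trans (cong (_* a) c≡0) (zeroˡ a))))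
        fr = frame (ψ tip) ψ-tip≢0
        open Frame fr
        Θ-linear : IsLinear (K ∘ ψ)
        Θ-linear = ∘-linear ψ-linear K-linear
        kerΘ : ∀ v → (K (ψ v) ≡ 0v) ⇔ (∃ λ c → v ≡ c · (a ∷ u))
        kerΘ v = ⇔-trans (injective⇒≡0⇔≡0 K-linear K-injective (ψ v)) (kerψ v)
        open TipFixing Θ-linear K-tip
        N′ : RepMatroid
        N′ = shadow-pushforward {N = N} Θ-linear K-tip

  step-from-cone : ∀ {N Y} → Step (cone N) Y → MinorOrConeOfMinor N Y
  step-from-cone (reembed ψ ψ-linear ψ-injective Y≡ψcone) =
    cone-of-minor ε (ψ , ψ-linear , ψ-injective , Y≡ψcone)
  step-from-cone (restrict φ φ-linear φ-injective Y≡φ⁻¹cone)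
    with Vec-searchable Carrier-searchable _ (λ v → φ v ≡ tip) (λ v → Vec.≡-dec _≟_ (φ v) tip)
  ... | yes (_ , φv₀≡tip) = restriction-through-tip φ φ-linear φ-injective Y≡φ⁻¹cone φv₀≡tip
  ... | no ∄v→tip =
    minor (restriction-avoiding-tip φ φ-linear φ-injective Y≡φ⁻¹cone ∄v→tip ◅ ε)
  step-from-cone (contract (a ∷ u) (inj₁ (u≡0 , a≢0)) ψ ψ-linear kerψ Y≡ψcone) =
    minor (contraction-of-tip ψ ψ-linear kerψ Y≡ψcone a≢0 u≡0 ◅ ε)
  step-from-cone (contract (a ∷ u) (inj₂ u∈N) ψ ψ-linear kerψ Y≡ψcone) =
    contraction-off-tip ψ ψ-linear kerψ Y≡ψcone u∈N

  MinorOrConeOfMinor-step : ∀ {N X Y} → MinorOrConeOfMinor N X → Step X Y →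
                            MinorOrConeOfMinor N Y
  MinorOrConeOfMinor-step (minor X≤N) s = minor (X≤N ◅◅ s ◅ ε)
  MinorOrConeOfMinor-step {Y = Y} (cone-of-minor {N′} N′≤N cone≅X) s
    with step-along-Equivalent {cone N′} cone≅X s
  ... | Y′ , s′ , Y′≅Y with step-from-cone s′
  ...   | minor Y′≤N′ = minor (N′≤N ◅◅ Y′≤N′ ◅◅ Equivalent⇒Step Y′≅Y ◅ ε)
  ...   | cone-of-minor {N″} N″≤N′ cone≅Y′ =
    cone-of-minor (N′≤N ◅◅ N″≤N′) (Equivalent-trans {cone N″} {Y′} {Y} cone≅Y′ Y′≅Y)

  MinorOrConeOfMinor-minor : ∀ {N X Y} → MinorOrConeOfMinor N X → IsInducedMinor Y X →
                             MinorOrConeOfMinor N Y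
  MinorOrConeOfMinor-minor N⇝X ε = N⇝X
  MinorOrConeOfMinor-minor N⇝X (s ◅ Y≤X′) =
    MinorOrConeOfMinor-minor (MinorOrConeOfMinor-step N⇝X s) Y≤X′

  Hat-closed : ∀ 𝓜 → ClosedUnderInducedMinors 𝓜 → ClosedUnderInducedMinors (Hat 𝓜)
  Hat-closed 𝓜 closed M N (base M∈𝓜) N≤M = base (closed M N M∈𝓜 N≤M)
  Hat-closed 𝓜 closed M N (coned {N₀} N₀∈𝓜̂ cone≅M) N≤M
    with MinorOrConeOfMinor-minor (cone-of-minor ε cone≅M) N≤M
  ... | minor N≤N₀ = Hat-closed 𝓜 closed N₀ N N₀∈𝓜̂ N≤N₀
  ... | cone-of-minor N′≤N₀ cone≅N = coned (Hat-closed 𝓜 closed N₀ _ N₀∈𝓜̂ N′≤N₀) cone≅N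

theorem1p5 : (q : ℕ) → IsPrimePower q → (F : FiniteField q) →
    (𝓜 : OverField.Class F) →
    OverField.ClosedUnderInducedMinors F 𝓜 →
    OverField.ClosedUnderInducedMinors F (OverField.Hat F 𝓜)
theorem1p5 q _ F = Hat-closed F
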